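{- Let $a,b,c\in\mathbb{N}$. Then $f(a,b,c)\ge \left\lfloor \frac{a+b+c}{2}\right\rfloor-1$.
   Context: $\mathbb{N}$ denotes the positive integers and $[n]=\{1,\dots,n\}$. For $a,b,c\in\mathbb{N}$, $f(a,b,c)$ denotes the metric dimension of the Cartesian product $K_a\times K_b\times K_c$ of complete graphs, i.e. the graph with vertex set $[a]\times[b]\times[c]$ in which two triples are adjacent iff they differ in exactly one coordinate; the metric dimension of a graph is the minimum size of a vertex set $U$ such that every vertex is uniquely determined by its vector of distances to the vertices of $U$. Equivalently (distance $=3-$ number of agreeing coordinates), $f(a,b,c)$ is the minimum cardinality of a set $Q\subseteq[a]\times[b]\times[c]$ such that for all distinct $s,s'\in[a]\times[b]\times[c]$ there is $q\in Q$ with $g(s,q)\neq g(s',q)$, where $g(s,q)$ is the number of indices $i\in[3]$ with $s_i=q_i$. -}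

module Defs where

open import Data.Nat using (ℕ; zero; suc; _+_; _∸_)
open import Data.Fin using (Fin; _≟_)
open import Data.Product using (_×_; _,_; ∃-syntax)
open import Data.List using (List)
open import Data.List.Membership.Propositional using (_∈_)
open import Relation.Nullary using (¬_; yes; no)
open import Relation.Binary.PropositionalEquality using (_≡_)

-- vertices of K_a × K_b × K_c : triples in [a]×[b]×[c] (Fin n ≅ [n])
Vertex : ℕ → ℕ → ℕ → Set
Vertex a b c = Fin a × Fin b × Fin c

agree : ∀ {n} → Fin n → Fin n → ℕ
agree i j with i ≟ j
... | yes _ = 1
... | no  _ = 0

g : ∀ {a b c} → Vertex a b c → Vertex a b c → ℕ
g (x , y , z) (x' , y' , z') = agree x x' + agree y y' + agree z z'

-- graph distance in K_a × K_b × K_c (Hamming distance) = 3 − g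
dist : ∀ {a b c} → Vertex a b c → Vertex a b c → ℕ
dist s q = 3 ∸ g s q

Resolving : ∀ {a b c} → List (Vertex a b c) → Set
Resolving {a} {b} {c} Q =
  (s s' : Vertex a b c) → ¬ (s ≡ s') → ∃[ q ] (q ∈ Q × ¬ (dist s q ≡ dist s' q))

{-# OPTIONS --safe #-}
module Submission where

-- View Q as n landmarks and project them onto each coordinate.  A value is unused if no landmark
-- has it, and a landmark is lone in a coordinate if no other landmark shares its value there.
-- Every value is hit at least twice, or is unused (2 short) or held by a lone landmark (1 short),
-- so a coordinate with m values has 2m ≤ n + lones + 2·unused.  Comparing vertices that differ in
-- two coordinates i, j shows that a resolving set allows at most one unused value per coordinate,
-- at most one landmark lone in both i and j, and never such a landmark together with unused
-- values in both i and j; hence unusedᵢ + unusedⱼ + jointLonesᵢⱼ ≤ 2.  A landmark lone in k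
-- coordinates is counted in C(k,2) ≥ k − 1 joint pairs, and summing gives 2(a+b+c) ≤ 4n + 6.

open import Defs
open import Data.Nat using (ℕ; suc; _+_; _∸_; _≤_; _/_)
open import Data.List using (List; length)
open import Data.List.Relation.Unary.Unique.Propositional using (Unique)

open import Data.Empty using (⊥)
open import Data.Fin using (Fin; zero; suc; _≟_)
open import Data.Fin.Properties using (suc-injective)
open import Data.List using (lookup; []; _∷_)
open import Data.List.Relation.Unary.Any using (index)
open import Data.List.Relation.Unary.Any.Properties using (lookup-index)
open import Data.Nat using (zero; _*_; _<_; z≤n; s≤s; z<s)
open import Data.Nat.DivMod using (m<n*o⇒m/o<n)
open import Data.Nat.Properties
  using ( +-*-semiring; module ≤-Reasoning; ≤-refl; ≤-reflexive; ≤-trans; ≤-pred; n≤1+n; 1+n≰n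
        ; ≮⇒≥; n≤0⇒n≡0; m≤m+n; m≤n+m; m+n≤o⇒n≤o; +-assoc; +-comm; +-identityʳ; *-identityʳ
        ; +-mono-≤; +-monoˡ-≤; +-monoʳ-≤; *-mono-≤; *-cancelʳ-≤; ∸-monoˡ-≤ )
open import Data.Nat.Tactic.RingSolver using (solve)
open import Data.Product using (_×_; _,_; proj₁; proj₂; ∃-syntax)
open import Data.Product.Properties using (≡-dec)
open import Function using (_∘_; _⇔_; mk⇔; Equivalence)
open import Relation.Nullary using (yes; no; contradiction)
open import Relation.Nullary.Decidable using (decidable-stable)
open import Relation.Binary.PropositionalEquality
open import Algebra.Properties.Semiring.Sum +-*-semiring
  using (sum; sum-syntax; sum-cong-≗; sum-replicate-zero; ∑-distrib-+; ∑-comm; *-distribʳ-sum)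

private variable
  a b c n m m′ : ℕ

agree-≡ : {x y : Fin m} → x ≡ y → agree x y ≡ 1
agree-≡ {x = x} {y} x≡y with x ≟ y
... | yes _   = refl
... | no x≢y = contradiction x≡y x≢y

agree-cong : {x y : Fin m} {x′ y′ : Fin m′} → (x ≡ y ⇔ x′ ≡ y′) → agree x y ≡ agree x′ y′
agree-cong {x = x} {y} {x′} {y′} x≡y⇔x′≡y′ with x ≟ y | x′ ≟ y′
... | yes _   | yes _     = refl
... | no _    | no _      = refl
... | yes x≡y | no x′≢y′  = contradiction (Equivalence.to x≡y⇔x′≡y′ x≡y) x′≢y′
... | no x≢y  | yes x′≡y′ = contradiction (Equivalence.from x≡y⇔x′≡y′ x′≡y′) x≢y

δ₀ : ℕ → ℕ
δ₀ zero    = 1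
δ₀ (suc _) = 0

δ₁ : ℕ → ℕ
δ₁ 1 = 1
δ₁ _ = 0

δ₀≤1 : ∀ d → δ₀ d ≤ 1
δ₀≤1 zero    = s≤s z≤n
δ₀≤1 (suc _) = z≤n

δ₁≤1 : ∀ d → δ₁ d ≤ 1
δ₁≤1 0             = z≤n
δ₁≤1 1             = s≤s z≤n
δ₁≤1 (suc (suc _)) = z≤n

δ₀-pos : ∀ d → 0 < δ₀ d → d ≡ 0
δ₀-pos zero _ = refl

δ₁*δ₁-pos : ∀ d e → 0 < δ₁ d * δ₁ e → d ≡ 1 × e ≡ 1
δ₁*δ₁-pos 1             1             _  = refl , refl
δ₁*δ₁-pos 0             _             ()
δ₁*δ₁-pos (suc (suc _)) _             ()
δ₁*δ₁-pos 1             0             ()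
δ₁*δ₁-pos 1             (suc (suc _)) ()

2≤d*[1+δ₁d]+δ₀d*2 : ∀ d → 2 ≤ d * suc (δ₁ d) + δ₀ d * 2
2≤d*[1+δ₁d]+δ₀d*2 0             = ≤-refl
2≤d*[1+δ₁d]+δ₀d*2 1             = ≤-refl
2≤d*[1+δ₁d]+δ₀d*2 (suc (suc _)) = s≤s (s≤s z≤n)

u+v+w≤1+uv+vw+wu : ∀ {u v w} → u ≤ 1 → v ≤ 1 → w ≤ 1 →
                   u + v + w ≤ 1 + (u * v + v * w + w * u)
u+v+w≤1+uv+vw+wu z≤n       z≤n       z≤n       = z≤n
u+v+w≤1+uv+vw+wu z≤n       z≤n       (s≤s z≤n) = ≤-refl
u+v+w≤1+uv+vw+wu z≤n       (s≤s z≤n) z≤n       = ≤-refl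
u+v+w≤1+uv+vw+wu z≤n       (s≤s z≤n) (s≤s z≤n) = ≤-refl
u+v+w≤1+uv+vw+wu (s≤s z≤n) z≤n       z≤n       = ≤-refl
u+v+w≤1+uv+vw+wu (s≤s z≤n) z≤n       (s≤s z≤n) = ≤-refl
u+v+w≤1+uv+vw+wu (s≤s z≤n) (s≤s z≤n) z≤n       = ≤-refl
u+v+w≤1+uv+vw+wu (s≤s z≤n) (s≤s z≤n) (s≤s z≤n) = n≤1+n 3

u+v+w≤2 : ∀ {u v w} → u ≤ 1 → v ≤ 1 → w ≤ 1 → (0 < u → 0 < v → 0 < w → ⊥) → u + v + w ≤ 2
u+v+w≤2 z≤n       z≤n       w≤1       _         = ≤-trans w≤1 (n≤1+n 1)
u+v+w≤2 z≤n       (s≤s z≤n) w≤1       _         = s≤s w≤1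
u+v+w≤2 (s≤s z≤n) z≤n       w≤1       _         = s≤s w≤1
u+v+w≤2 (s≤s z≤n) (s≤s z≤n) z≤n       _         = ≤-refl
u+v+w≤2 (s≤s z≤n) (s≤s z≤n) (s≤s z≤n) exclusive = contradiction (exclusive z<s z<s z<s) λ ()

∑-const : ∀ n k → ∑[ i < n ] k ≡ n * k
∑-const zero    k = refl
∑-const (suc n) k = cong (k +_) (∑-const n k)

∑-distrib-+₃ : (f g h : Fin n → ℕ) → ∑[ i < n ] (f i + g i + h i) ≡ sum f + sum g + sum h
∑-distrib-+₃ f g h = trans (∑-distrib-+ (λ i → f i + g i) h) (cong (_+ sum h) (∑-distrib-+ f g))

∑-mono-≤ : {f h : Fin n → ℕ} → (∀ i → f i ≤ h i) → sum f ≤ sum h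
∑-mono-≤ {zero}  f≤h = z≤n
∑-mono-≤ {suc n} f≤h = +-mono-≤ (f≤h zero) (∑-mono-≤ (f≤h ∘ suc))

≤-∑ : (f : Fin n → ℕ) (i : Fin n) → f i ≤ sum f
≤-∑ f zero    = m≤m+n (f zero) _
≤-∑ f (suc i) = ≤-trans (≤-∑ (f ∘ suc) i) (m≤n+m _ (f zero))

∑-pos : (f : Fin n → ℕ) → 0 < sum f → ∃[ i ] 0 < f i
∑-pos {suc n} f ∑f>0 with f zero in f₀≡
... | suc _ = zero , subst (0 <_) (sym f₀≡) z<s
... | zero  = let i , fi>0 = ∑-pos (f ∘ suc) ∑f>0 in suc i , fi>0

∑≤1⇒support-unique : (f : Fin n → ℕ) → sum f ≤ 1 → ∀ {i j} → 0 < f i → 0 < f j → i ≡ j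
∑≤1⇒support-unique f ∑f≤1 {zero}  {zero}  _    _    = refl
∑≤1⇒support-unique f ∑f≤1 {zero}  {suc j} fi>0 fj>0 =
  contradiction (≤-trans (+-mono-≤ fi>0 (≤-trans fj>0 (≤-∑ (f ∘ suc) j))) ∑f≤1) (1+n≰n {1})
∑≤1⇒support-unique f ∑f≤1 {suc i} {zero}  fi>0 fj>0 = sym (∑≤1⇒support-unique f ∑f≤1 fj>0 fi>0)
∑≤1⇒support-unique f ∑f≤1 {suc i} {suc j} fi>0 fj>0 =
  cong suc (∑≤1⇒support-unique (f ∘ suc) (m+n≤o⇒n≤o (f zero) ∑f≤1) fi>0 fj>0)

support-unique⇒∑≤1 : (f : Fin n → ℕ) → (∀ i → f i ≤ 1) →
                     (∀ {i j} → 0 < f i → 0 < f j → i ≡ j) → sum f ≤ 1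
support-unique⇒∑≤1 {zero}  _ _   _      = z≤n
support-unique⇒∑≤1 {suc n} f f≤1 unique with f zero in f₀≡ | f≤1 zero
... | 0           | _      =
  support-unique⇒∑≤1 (f ∘ suc) (f≤1 ∘ suc) (λ fi>0 fj>0 → suc-injective (unique fi>0 fj>0))
... | 1           | _      = s≤s (≮⇒≥ λ ∑>0 →
  let i , fi>0 = ∑-pos (f ∘ suc) ∑>0 in contradiction (unique (≤-reflexive (sym f₀≡)) fi>0) λ ())
... | suc (suc _) | s≤s ()

∑-agree-* : (y : Fin m) (h : Fin m → ℕ) → ∑[ x < m ] (agree x y * h x) ≡ h y
∑-agree-* {suc m} zero h =
  trans (cong₂ _+_ (+-identityʳ (h zero)) (sum-replicate-zero m)) (+-identityʳ (h zero))
∑-agree-* {suc m} (suc y) h = begin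
  ∑[ x < m ] (agree (suc x) (suc y) * h (suc x))
    ≡⟨ sum-cong-≗ (λ x → cong (_* h (suc x)) (agree-suc x)) ⟩
  ∑[ x < m ] (agree x y * h (suc x))
    ≡⟨ ∑-agree-* y (h ∘ suc) ⟩
  h (suc y)
    ∎
  where
  open ≡-Reasoning
  agree-suc : ∀ x → agree (suc x) (suc y) ≡ agree x y
  agree-suc _ = agree-cong (mk⇔ suc-injective (cong suc))

module _ (p : Fin n → Fin m) where

  degree : Fin m → ℕ
  degree x = ∑[ k < n ] agree x (p k)

  unused : ℕ
  unused = ∑[ x < m ] δ₀ (degree x)

  lone : Fin n → ℕ
  lone k = δ₁ (degree (p k))

  lones : ℕ
  lones = ∑[ k < n ] lone k

  lone≤1 : ∀ k → lone k ≤ 1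
  lone≤1 k = δ₁≤1 (degree (p k))

  ∑-degree-* : (h : Fin m → ℕ) → ∑[ x < m ] (degree x * h x) ≡ ∑[ k < n ] h (p k)
  ∑-degree-* h = begin
    ∑[ x < m ] (degree x * h x)
      ≡⟨ sum-cong-≗ (λ x → *-distribʳ-sum (h x) (λ k → agree x (p k))) ⟩
    ∑[ x < m ] ∑[ k < n ] (agree x (p k) * h x)
      ≡⟨ ∑-comm (λ x k → agree x (p k) * h x) ⟩
    ∑[ k < n ] ∑[ x < m ] (agree x (p k) * h x)
      ≡⟨ sum-cong-≗ (λ k → ∑-agree-* (p k) h) ⟩
    ∑[ k < n ] h (p k)
      ∎
    where open ≡-Reasoning

  coverage : m * 2 ≤ n + lones + unused * 2
  coverage = begin
    m * 2
      ≡⟨ ∑-const m 2 ⟨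
    ∑[ x < m ] 2
      ≤⟨ ∑-mono-≤ (λ x → 2≤d*[1+δ₁d]+δ₀d*2 (degree x)) ⟩
    ∑[ x < m ] (degree x * weight x + δ₀ (degree x) * 2)
      ≡⟨ ∑-distrib-+ (λ x → degree x * weight x) (λ x → δ₀ (degree x) * 2) ⟩
    ∑[ x < m ] (degree x * weight x) + ∑[ x < m ] (δ₀ (degree x) * 2)
      ≡⟨ cong₂ _+_ (∑-degree-* weight) (sym (*-distribʳ-sum 2 (δ₀ ∘ degree))) ⟩
    ∑[ k < n ] (1 + lone k) + unused * 2
      ≡⟨ cong (_+ unused * 2) (∑-distrib-+ (λ _ → 1) lone) ⟩
    ∑[ k < n ] 1 + lones + unused * 2
      ≡⟨ cong (λ t → t + lones + unused * 2) (trans (∑-const n 1) (*-identityʳ n)) ⟩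
    n + lones + unused * 2
      ∎
    where
    open ≤-Reasoning
    weight : Fin m → ℕ
    weight x = suc (δ₁ (degree x))

  unused-agree : ∀ {x} → degree x ≡ 0 → ∀ k → agree x (p k) ≡ 0
  unused-agree deg≡0 k = n≤0⇒n≡0 (subst (agree _ (p k) ≤_) deg≡0 (≤-∑ _ k))

  lone-injective : ∀ {k₀ k} → degree (p k₀) ≡ 1 → p k₀ ≡ p k → k₀ ≡ k
  lone-injective deg≡1 pk₀≡pk = ∑≤1⇒support-unique _ (≤-reflexive deg≡1)
    (≤-reflexive (sym (agree-≡ refl))) (≤-reflexive (sym (agree-≡ pk₀≡pk)))

  lone-agree : ∀ {k₀} → degree (p k₀) ≡ 1 → ∀ k → agree (p k₀) (p k) ≡ agree k₀ k
  lone-agree deg≡1 k = agree-cong (mk⇔ (lone-injective deg≡1) (cong p))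

HitBySame : (Fin n → Fin m) → (Fin n → Fin m′) → Fin m → Fin m′ → Set
HitBySame p p′ x y = ∀ k → agree x (p k) ≡ agree y (p′ k)

Separating : (Fin n → Fin m) → Set
Separating p = ∀ {x x′} → HitBySame p p x x′ → x ≡ x′

Swappable : (Fin n → Fin m) → (Fin n → Fin m′) → Set
Swappable p p′ = ∀ {x x′ y y′} → HitBySame p p′ x y → HitBySame p p′ x′ y′ → x ≡ x′

jointLone : (Fin n → Fin m) → (Fin n → Fin m′) → Fin n → ℕ
jointLone p p′ k = lone p k * lone p′ k

jointLones : (Fin n → Fin m) → (Fin n → Fin m′) → ℕ
jointLones {n = n} p p′ = ∑[ k < n ] jointLone p p′ k

unused-hitBySame : (p : Fin n → Fin m) (p′ : Fin n → Fin m′) → ∀ {x y} →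
                   degree p x ≡ 0 → degree p′ y ≡ 0 → HitBySame p p′ x y
unused-hitBySame p p′ deg≡0 deg′≡0 k =
  trans (unused-agree p deg≡0 k) (sym (unused-agree p′ deg′≡0 k))

unused-≤1 : (p : Fin n → Fin m) → Separating p → unused p ≤ 1
unused-≤1 p separating = support-unique⇒∑≤1 (δ₀ ∘ degree p) (δ₀≤1 ∘ degree p) λ {x} {x′} x>0 x′>0 →
  separating (unused-hitBySame p p (δ₀-pos (degree p x) x>0) (δ₀-pos (degree p x′) x′>0))

module _ (p : Fin n → Fin m) (p′ : Fin n → Fin m′) where

  jointLone≤1 : ∀ k → jointLone p p′ k ≤ 1
  jointLone≤1 k = *-mono-≤ (lone≤1 p k) (lone≤1 p′ k)

  jointLone-pos : ∀ {k} → 0 < jointLone p p′ k → degree p (p k) ≡ 1 × degree p′ (p′ k) ≡ 1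
  jointLone-pos {k} = δ₁*δ₁-pos (degree p (p k)) (degree p′ (p′ k))

  lone-hitBySame : ∀ {k} → degree p (p k) ≡ 1 → degree p′ (p′ k) ≡ 1 → HitBySame p p′ (p k) (p′ k)
  lone-hitBySame deg≡1 deg′≡1 j = trans (lone-agree p deg≡1 j) (sym (lone-agree p′ deg′≡1 j))

  jointLones-≤1 : Swappable p p′ → jointLones p p′ ≤ 1
  jointLones-≤1 swappable = support-unique⇒∑≤1 (jointLone p p′) jointLone≤1 λ i>0 j>0 →
    let degᵢ≡1 , degᵢ′≡1 = jointLone-pos i>0
        degⱼ≡1 , degⱼ′≡1 = jointLone-pos j>0
    in  lone-injective p degᵢ≡1
          (swappable (lone-hitBySame degᵢ≡1 degᵢ′≡1) (lone-hitBySame degⱼ≡1 degⱼ′≡1))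

  unused-unused-jointLones-exclusive :
    Swappable p p′ → 0 < unused p → 0 < unused p′ → 0 < jointLones p p′ → ⊥
  unused-unused-jointLones-exclusive swappable unused>0 unused′>0 joint>0 =
    let x , x>0        = ∑-pos (δ₀ ∘ degree p) unused>0
        y , y>0        = ∑-pos (δ₀ ∘ degree p′) unused′>0
        k , k>0        = ∑-pos (jointLone p p′) joint>0
        degₓ≡0         = δ₀-pos (degree p x) x>0
        deg≡1 , deg′≡1 = jointLone-pos k>0
        pk≡x           = swappable (lone-hitBySame deg≡1 deg′≡1)
                                   (unused-hitBySame p p′ degₓ≡0 (δ₀-pos (degree p′ y) y>0))
    in  contradiction (trans (sym (agree-≡ (sym pk≡x))) (unused-agree p degₓ≡0 k)) λ ()

  pair-bound : Separating p → Separating p′ → Swappable p p′ →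
               unused p + unused p′ + jointLones p p′ ≤ 2
  pair-bound separating separating′ swappable =
    u+v+w≤2 (unused-≤1 p separating) (unused-≤1 p′ separating′) (jointLones-≤1 swappable)
      (unused-unused-jointLones-exclusive swappable)

lones-triple : (p₁ : Fin n → Fin a) (p₂ : Fin n → Fin b) (p₃ : Fin n → Fin c) →
               lones p₁ + lones p₂ + lones p₃ ≤
               n + (jointLones p₁ p₂ + jointLones p₂ p₃ + jointLones p₃ p₁)
lones-triple {n = n} p₁ p₂ p₃ = begin
  lones p₁ + lones p₂ + lones p₃
    ≡⟨ ∑-distrib-+₃ (lone p₁) (lone p₂) (lone p₃) ⟨
  ∑[ k < n ] (lone p₁ k + lone p₂ k + lone p₃ k)
    ≤⟨ ∑-mono-≤ (λ k → u+v+w≤1+uv+vw+wu (lone≤1 p₁ k) (lone≤1 p₂ k) (lone≤1 p₃ k)) ⟩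
  ∑[ k < n ] (1 + (j₁₂ k + j₂₃ k + j₃₁ k))
    ≡⟨ ∑-distrib-+ (λ _ → 1) (λ k → j₁₂ k + j₂₃ k + j₃₁ k) ⟩
  ∑[ k < n ] 1 + ∑[ k < n ] (j₁₂ k + j₂₃ k + j₃₁ k)
    ≡⟨ cong₂ _+_ (trans (∑-const n 1) (*-identityʳ n)) (∑-distrib-+₃ j₁₂ j₂₃ j₃₁) ⟩
  n + (jointLones p₁ p₂ + jointLones p₂ p₃ + jointLones p₃ p₁)
    ∎
  where
  open ≤-Reasoning
  j₁₂ j₂₃ j₃₁ : Fin n → ℕ
  j₁₂ = jointLone p₁ p₂
  j₂₃ = jointLone p₂ p₃
  j₃₁ = jointLone p₃ p₁

first : Vertex a b c → Fin a
first = proj₁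

second : Vertex a b c → Fin b
second = proj₁ ∘ proj₂

third : Vertex a b c → Fin c
third = proj₂ ∘ proj₂

Resolves : (Fin n → Vertex a b c) → Set
Resolves q = ∀ s s′ → (∀ k → g s (q k) ≡ g s′ (q k)) → s ≡ s′

resolving⇒resolves : {Q : List (Vertex a b c)} → Resolving Q → Resolves (lookup Q)
resolving⇒resolves resolving s s′ same =
  decidable-stable (≡-dec _≟_ (≡-dec _≟_ _≟_) s s′) λ s≢s′ →
    let r , r∈Q , differ = resolving s s′ s≢s′
    in  differ (subst (λ t → dist s t ≡ dist s′ t) (sym (lookup-index r∈Q))
                      (cong (3 ∸_) (same (index r∈Q))))

rotate : Vertex a b c → Vertex b c a
rotate (x , y , z) = y , z , x

g-rotate : (s t : Vertex a b c) → g (rotate s) (rotate t) ≡ g s t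
g-rotate (x , y , z) (x′ , y′ , z′) = sym (trans (+-assoc (agree x x′) _ _) (+-comm (agree x x′) _))

rotate-resolves : {q : Fin n → Vertex a b c} → Resolves q → Resolves (rotate ∘ q)
rotate-resolves {q = q} resolves s s′ same =
  cong rotate (resolves (rotate (rotate s)) (rotate (rotate s′)) λ k →
    trans (sym (g-rotate (rotate (rotate s)) (q k)))
          (trans (same k) (g-rotate (rotate (rotate s′)) (q k))))

module _ (q : Fin n → Vertex (suc a) (suc b) (suc c)) (resolves : Resolves q) where

  first-separating : Separating (first ∘ q)
  first-separating {x} {x′} same = cong first (resolves (x , zero , zero) (x′ , zero , zero) λ k →
    cong (λ t → t + agree zero (second (q k)) + agree zero (third (q k))) (same k))

  second-separating : Separating (second ∘ q)
  second-separating {y} {y′} same = cong second (resolves (zero , y , zero) (zero , y′ , zero) λ k →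
    cong (λ t → agree zero (first (q k)) + t + agree zero (third (q k))) (same k))

  first-second-swappable : Swappable (first ∘ q) (second ∘ q)
  first-second-swappable {x} {x′} {y} {y′} x~y x′~y′ =
    cong first (resolves (x , y′ , zero) (x′ , y , zero) λ k →
      cong (_+ agree zero (third (q k))) (begin
        agree x (first (q k)) + agree y′ (second (q k))  ≡⟨ cong₂ _+_ (x~y k) (sym (x′~y′ k)) ⟩
        agree y (second (q k)) + agree x′ (first (q k))  ≡⟨ +-comm (agree y (second (q k))) _ ⟩
        agree x′ (first (q k)) + agree y (second (q k))  ∎))
    where open ≡-Reasoning

  resolving-pair-bound :
    unused (first ∘ q) + unused (second ∘ q) + jointLones (first ∘ q) (second ∘ q) ≤ 2
  resolving-pair-bound =
    pair-bound (first ∘ q) (second ∘ q) first-separating second-separating first-second-swappable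

arith-bound : ∀ n A B C L₁ L₂ L₃ M₁ M₂ M₃ J₁₂ J₂₃ J₃₁ →
              A * 2 ≤ n + L₁ + M₁ * 2 → B * 2 ≤ n + L₂ + M₂ * 2 → C * 2 ≤ n + L₃ + M₃ * 2 →
              L₁ + L₂ + L₃ ≤ n + (J₁₂ + J₂₃ + J₃₁) →
              M₁ + M₂ + J₁₂ ≤ 2 → M₂ + M₃ + J₂₃ ≤ 2 → M₃ + M₁ + J₃₁ ≤ 2 →
              A + B + C ≤ 3 + n * 2
arith-bound n A B C L₁ L₂ L₃ M₁ M₂ M₃ J₁₂ J₂₃ J₃₁ cov₁ cov₂ cov₃ lones≤ pair₁₂ pair₂₃ pair₃₁ =
  *-cancelʳ-≤ (A + B + C) (3 + n * 2) 2 (begin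
    (A + B + C) * 2
      ≡⟨ solve (A ∷ B ∷ C ∷ []) ⟩
    A * 2 + B * 2 + C * 2
      ≤⟨ +-mono-≤ (+-mono-≤ cov₁ cov₂) cov₃ ⟩
    (n + L₁ + M₁ * 2) + (n + L₂ + M₂ * 2) + (n + L₃ + M₃ * 2)
      ≡⟨ solve (n ∷ L₁ ∷ L₂ ∷ L₃ ∷ M₁ ∷ M₂ ∷ M₃ ∷ []) ⟩
    n * 3 + (L₁ + L₂ + L₃) + (M₁ + M₂ + M₃) * 2
      ≤⟨ +-monoˡ-≤ _ (+-monoʳ-≤ (n * 3) lones≤) ⟩
    n * 3 + (n + (J₁₂ + J₂₃ + J₃₁)) + (M₁ + M₂ + M₃) * 2
      ≡⟨ solve (n ∷ J₁₂ ∷ J₂₃ ∷ J₃₁ ∷ M₁ ∷ M₂ ∷ M₃ ∷ []) ⟩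
    n * 4 + ((M₁ + M₂ + J₁₂) + (M₂ + M₃ + J₂₃) + (M₃ + M₁ + J₃₁))
      ≤⟨ +-monoʳ-≤ (n * 4) (+-mono-≤ (+-mono-≤ pair₁₂ pair₂₃) pair₃₁) ⟩
    n * 4 + 6
      ≡⟨ solve (n ∷ []) ⟩
    (3 + n * 2) * 2
      ∎)
  where open ≤-Reasoning

m≤3+n*2⇒m/2∸1≤n : ∀ {m n} → m ≤ 3 + n * 2 → m / 2 ∸ 1 ≤ n
m≤3+n*2⇒m/2∸1≤n m≤ = ∸-monoˡ-≤ 1 (≤-pred (m<n*o⇒m/o<n {o = 2} (s≤s m≤)))

theorem1 : (a b c : ℕ) → (Q : List (Vertex (suc a) (suc b) (suc c))) →
    Unique Q → Resolving Q →
    ((suc a + suc b + suc c) / 2) ∸ 1 ≤ length Q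
theorem1 a b c Q _ resolving = m≤3+n*2⇒m/2∸1≤n (arith-bound (length Q) (suc a) (suc b) (suc c)
    (lones q₁) (lones q₂) (lones q₃) (unused q₁) (unused q₂) (unused q₃)
    (jointLones q₁ q₂) (jointLones q₂ q₃) (jointLones q₃ q₁)
    (coverage q₁) (coverage q₂) (coverage q₃) (lones-triple q₁ q₂ q₃) pair₁₂ pair₂₃ pair₃₁)
  where
  q = lookup Q
  resolves = resolving⇒resolves resolving
  q₁ = first ∘ q
  q₂ = second ∘ q
  q₃ = third ∘ q
  pair₁₂ : unused q₁ + unused q₂ + jointLones q₁ q₂ ≤ 2
  pair₁₂ = resolving-pair-bound q resolves
  pair₂₃ : unused q₂ + unused q₃ + jointLones q₂ q₃ ≤ 2
  pair₂₃ = resolving-pair-bound (rotate ∘ q) (rotate-resolves resolves)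
  pair₃₁ : unused q₃ + unused q₁ + jointLones q₃ q₁ ≤ 2
  pair₃₁ = resolving-pair-bound (rotate ∘ rotate ∘ q) (rotate-resolves (rotate-resolves resolves))
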